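{- Let $\delta,k\in\mathbb{Z}^+$ with $\delta>0$. Set $\alpha'=2^k/\delta+1$, $\varepsilon=\delta-2^k\%\delta$ and $M=\lceil 2^k\cdot\varepsilon^{ -1}\rceil$. If $\varepsilon\le\alpha'$, then $n\%\delta=\delta\cdot(\alpha'\cdot n\%2^k)/2^k$ for all $n\in[0,M[$.
   Context: For $n,\delta\in\mathbb{Z}$ with $\delta\neq0$, $n/\delta$ and $n\%\delta$ denote the quotient and remainder of Euclidean division: the unique integers $q,s$ with $n=q\cdot\delta+s$ and $0\le s<|\delta|$. The operators $\cdot$, $/$, $\%$ have equal precedence and associate left to right (so $\delta\cdot(\alpha'\cdot n\%2^k)/2^k=(\delta\cdot((\alpha'\cdot n)\%2^k))/2^k$). $2^k\cdot\varepsilon^{ -1}$ is the rational number $2^k/\varepsilon$ and $\lceil\cdot\rceil$ is the ceiling. $\mathbb{Z}^+=\{x\in\mathbb{Z}: x\ge0\}$. For integers $a,b$, $[a,b[$ denotes $\{r\in\mathbb{Z}: a\le r<b\}$. -}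

module Defs where

open import Data.Nat using (ℕ; zero; suc; _+_; _∸_)
open import Data.Nat.DivMod using (_/_)

-- The case b = 0 never arises in the
-- statement (there ε ≥ 1 always) and is given an arbitrary value.
⌈_/_⌉ : ℕ → ℕ → ℕ
⌈ a / zero ⌉ = zero
⌈ a / suc e ⌉ = (a + e) / suc e

module Submission where

open import Defs
open import Data.Nat using (ℕ; suc; _+_; _*_; _∸_; _^_; _≤_; _<_; NonZero; >-nonZero)
open import Data.Nat.DivMod
  using (_/_; _%_; m≡m%n+[m/n]*n; m%n<n; [m+kn]%n≡m%n; m<n⇒m%n≡m; m<n⇒m/n≡0;
         m*n/n≡m; m/n*n≤m; +-distrib-/-∣ʳ)
open import Data.Nat.Divisibility using (divides-refl)
open import Data.Nat.Properties
  using (m^n≢0; +-comm; *-comm; m∸n+n≡m; <⇒≤; m<n⇒0<n∸m; n<1+n; +-cancelʳ-<;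
         *-cancelˡ-<; +-monoˡ-<; *-monoˡ-≤; module ≤-Reasoning)
open import Data.List.Base using (_∷_; [])
open import Data.Nat.Tactic.RingSolver using (solve)
open import Relation.Binary.PropositionalEquality
  using (_≡_; refl; sym; trans; cong; cong₂; module ≡-Reasoning)

-- Write P = 2 ^ k as q δ + r, so ε = δ - r, and n = a δ + b with b = n % δ.  Then
--   (q + 1) n = X + a P   and   δ X = ε n + b P,   where X = a ε + (q + 1) b.
-- If ε n < P, the second identity gives δ X < (b + 1) P ≤ δ P, so X < P.
-- Hence (q + 1) n % P = X, and δ X / P = b because ε n < P.

[m+kn]/n≡k : ∀ m k n .{{_ : NonZero n}} → m < n → (m + k * n) / n ≡ k
[m+kn]/n≡k m k n m<n =
  trans (+-distrib-/-∣ʳ m (divides-refl k)) (cong₂ _+_ (m<n⇒m/n≡0 m<n) (m*n/n≡m k n))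

<⌈/⌉⇒*< : ∀ {n a} b .{{_ : NonZero b}} → n < ⌈ a / b ⌉ → n * b < a
<⌈/⌉⇒*< {n} {a} b@(suc e) n<⌈a/b⌉ = +-cancelʳ-< e (n * b) a (begin-strict
  n * b + e           <⟨ n<1+n _ ⟩
  suc (n * b + e)     ≡⟨ cong suc (+-comm (n * b) e) ⟩
  suc n * b           ≤⟨ *-monoˡ-≤ b n<⌈a/b⌉ ⟩
  (a + e) / b * b     ≤⟨ m/n*n≤m (a + e) b ⟩
  a + e               ∎)
  where open ≤-Reasoning

multiply-shift-quotient : ∀ {n P δ} q r ε a b →
  n ≡ b + a * δ → P ≡ r + q * δ → δ ≡ ε + r →
  (q + 1) * n ≡ (a * ε + (q + 1) * b) + a * P
multiply-shift-quotient q r ε a b refl refl refl = solve (q ∷ r ∷ ε ∷ a ∷ b ∷ [])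

multiply-shift-remainder : ∀ {n P δ} q r ε a b →
  n ≡ b + a * δ → P ≡ r + q * δ → δ ≡ ε + r →
  δ * (a * ε + (q + 1) * b) ≡ ε * n + b * P
multiply-shift-remainder q r ε a b refl refl refl = solve (q ∷ r ∷ ε ∷ a ∷ b ∷ [])

%-via-multiply-shift : ∀ δ P .{{_ : NonZero δ}} .{{_ : NonZero P}} n →
  n * (δ ∸ P % δ) < P → n % δ ≡ δ * ((P / δ + 1) * n % P) / P
%-via-multiply-shift δ P n nε<P = sym δ[[q+1]n%P]/P≡b
  where
  q = P / δ
  r = P % δ
  ε = δ ∸ r
  a = n / δ
  b = n % δ
  X = a * ε + (q + 1) * b

  εn<P : ε * n < P
  εn<P rewrite *-comm ε n = nε<P

  P≡r+qδ : P ≡ r + q * δ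
  P≡r+qδ = m≡m%n+[m/n]*n P δ

  n≡b+aδ : n ≡ b + a * δ
  n≡b+aδ = m≡m%n+[m/n]*n n δ

  δ≡ε+r : δ ≡ ε + r
  δ≡ε+r = sym (m∸n+n≡m (<⇒≤ (m%n<n P δ)))

  [q+1]n≡X+aP : (q + 1) * n ≡ X + a * P
  [q+1]n≡X+aP = multiply-shift-quotient q r ε a b n≡b+aδ P≡r+qδ δ≡ε+r

  δX≡εn+bP : δ * X ≡ ε * n + b * P
  δX≡εn+bP = multiply-shift-remainder q r ε a b n≡b+aδ P≡r+qδ δ≡ε+r

  X<P : X < P
  X<P = *-cancelˡ-< δ X P (begin-strict
    δ * X           ≡⟨ δX≡εn+bP ⟩
    ε * n + b * P   <⟨ +-monoˡ-< (b * P) εn<P ⟩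
    suc b * P       ≤⟨ *-monoˡ-≤ P (m%n<n n δ) ⟩
    δ * P           ∎)
    where open ≤-Reasoning

  δ[[q+1]n%P]/P≡b : δ * ((q + 1) * n % P) / P ≡ b
  δ[[q+1]n%P]/P≡b = begin
    δ * ((q + 1) * n % P) / P   ≡⟨ cong (λ m → δ * (m % P) / P) [q+1]n≡X+aP ⟩
    δ * ((X + a * P) % P) / P   ≡⟨ cong (λ m → δ * m / P) ([m+kn]%n≡m%n X a P) ⟩
    δ * (X % P) / P             ≡⟨ cong (λ m → δ * m / P) (m<n⇒m%n≡m X<P) ⟩
    δ * X / P                   ≡⟨ cong (_/ P) δX≡εn+bP ⟩
    (ε * n + b * P) / P         ≡⟨ [m+kn]/n≡k (ε * n) b P εn<P ⟩
    b                           ∎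
    where open ≡-Reasoning

theorem6 : (d k : ℕ) →
    let δ = suc d
        α′ = 2 ^ k / δ + 1
        ε = δ ∸ 2 ^ k % δ
        M = ⌈ 2 ^ k / ε ⌉
    in ε ≤ α′ →
       (n : ℕ) → n < M →
       n % δ ≡ _/_ (δ * _%_ (α′ * n) (2 ^ k) {{m^n≢0 2 k}}) (2 ^ k) {{m^n≢0 2 k}}
theorem6 d k _ n n<M = %-via-multiply-shift δ P n (<⌈/⌉⇒*< (δ ∸ P % δ) n<M)
  where
  δ = suc d
  P = 2 ^ k
  instance
    P≢0 : NonZero P
    P≢0 = m^n≢0 2 k
    ε≢0 : NonZero (δ ∸ P % δ)
    ε≢0 = >-nonZero (m<n⇒0<n∸m (m%n<n P δ))
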